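{- Let $a_0,\dots,a_{15}\in\mathbb{Z}$, with $\alpha_1,\alpha_2,N_d$ as in the context. Suppose that $\Re(\alpha_1),\Im(\alpha_1),\Re(\alpha_2),\Im(\alpha_2)\in\{8m\pm1\mid m\in\mathbb{Z}\}$. Then $N_4\equiv N_8N_{16}+2\pmod{16}$.
   Context: Let $f(x)=\sum_{k=0}^{15}a_kx^k$, $\zeta_{16}=e^{2\pi\sqrt{ -1}/16}$ and $\zeta_8=\zeta_{16}^2$. Set $\alpha_1:=f(\zeta_{16})f(\zeta_{16}^5)f(\zeta_{16}^9)f(\zeta_{16}^{13})$ and $\alpha_2:=f(\zeta_8)f(\zeta_8^5)$; both lie in $\mathbb{Z}[\sqrt{ -1}]$. For each divisor $d$ of $16$, $N_d := \prod_{0\le l\le 15,\ \gcd(l,16)=d} f(\zeta_{16}^l)$ (with $\gcd(0,16)=16$); each $N_d$ is an integer. -}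

module Defs where

open import Data.Nat as ℕ using (ℕ; zero; suc)
open import Data.Nat.GCD using (gcd)
open import Data.Integer using (ℤ; +_; -_; _+_; _*_; _-_)
import Data.Fin
open Data.Fin using (Fin; toℕ)
open import Data.Vec using (Vec; []; _∷_; zipWith; map; toList; lookup; replicate)
open import Data.List as L using (List; []; _∷_; upTo; filter)
open import Data.Product using (Σ)
open import Data.Sum using (_⊎_)
open import Relation.Binary.PropositionalEquality using (_≡_)

-- Z[ζ₁₆] modelled concretely as Z[x]/(x⁸+1) = Z[x]/(Φ₁₆(x)), with ζ₁₆ ↦ x.
-- An element is its coefficient vector (c₀,…,c₇) w.r.t. the basis 1,ζ,…,ζ⁷.
Cyc : Set
Cyc = Vec ℤ 8

zeroC : Cyc
zeroC = replicate 8 (+ 0)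

oneC : Cyc
oneC = + 1 ∷ + 0 ∷ + 0 ∷ + 0 ∷ + 0 ∷ + 0 ∷ + 0 ∷ + 0 ∷ []

addC : Cyc → Cyc → Cyc
addC = zipWith _+_

scaleC : ℤ → Cyc → Cyc
scaleC c = map (c *_)

mulζ : Cyc → Cyc
mulζ (a0 ∷ a1 ∷ a2 ∷ a3 ∷ a4 ∷ a5 ∷ a6 ∷ a7 ∷ []) =
  (- a7) ∷ a0 ∷ a1 ∷ a2 ∷ a3 ∷ a4 ∷ a5 ∷ a6 ∷ []

mulAux : List ℤ → Cyc → Cyc
mulAux [] b = zeroC
mulAux (c ∷ cs) b = addC (scaleC c b) (mulAux cs (mulζ b))

mulC : Cyc → Cyc → Cyc
mulC a b = mulAux (toList a) b

ζpow : ℕ → Cyc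
ζpow zero = oneC
ζpow (suc n) = mulζ (ζpow n)

prodC : List Cyc → Cyc
prodC = L.foldr mulC oneC

-- f(ζ₁₆ ^ l) where f(x) = Σ_{k=0}^{15} a_k x^k
evalAt : (Fin 16 → ℤ) → ℕ → Cyc
evalAt a l = L.foldr addC zeroC (L.map (λ k → scaleC (a k) (ζpow (l ℕ.* toℕ k))) (L.allFin 16))

-- Real and imaginary parts of an element of Z[i] ⊂ Z[ζ₁₆] (i = ζ₁₆⁴):
-- coefficients of 1 and of ζ₁₆⁴.
Re Im : Cyc → ℤ
Re c = lookup c (Data.Fin.zero)
Im c = lookup c (Data.Fin.suc (Data.Fin.suc (Data.Fin.suc (Data.Fin.suc Data.Fin.zero))))

α₁ : (Fin 16 → ℤ) → Cyc
α₁ a = prodC (L.map (evalAt a) (1 ∷ 5 ∷ 9 ∷ 13 ∷ []))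

-- α₂ = f(ζ₈)f(ζ₈⁵) = f(ζ₁₆²)f(ζ₁₆¹⁰)
α₂ : (Fin 16 → ℤ) → Cyc
α₂ a = prodC (L.map (evalAt a) (2 ∷ 10 ∷ []))

-- N_d = ∏_{0≤l≤15, gcd(l,16)=d} f(ζ₁₆^l)   (gcd 0 16 = 16), an integer,
-- read off as the constant coefficient.
Nprod : (Fin 16 → ℤ) → ℕ → Cyc
Nprod a d = prodC (L.map (evalAt a) (filter (λ l → gcd l 16 ℕ.≟ d) (upTo 16)))

N : (Fin 16 → ℤ) → ℕ → ℤ
N a d = Re (Nprod a d)

Is8m±1 : ℤ → Set
Is8m±1 x = Σ ℤ (λ m → (x ≡ + 8 * m + + 1) ⊎ (x ≡ + 8 * m - + 1))

-- Reduce f modulo x⁸ + 1, x⁴ + 1 and x⁴ − 1 to coefficient vectors b, d and c. Then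
-- f(ζ)f(−ζ) = P + ζ²Q with P, Q ∈ ℤ[i] and α₁ = P² − iQ²; f(ζ₈) = E + ζ₈O with
-- α₂ = E² − iO²; and N₄ − N₈N₁₆ − 2 = 2(c₁² + c₃²) − 4c₀c₂ − 2. Since squaring doubles
-- 2-adic precision, α₁ mod 8 depends only on b mod 2, α₂ mod 8 only on d mod 4, and the
-- defect mod 16 only on c mod 4. As dᵢ ≡ bᵢ + bᵢ₊₄ (mod 2) and cᵢ ≡ dᵢ + 2bᵢ₊₄ (mod 4),
-- the hypotheses force the defect to vanish mod 16; this last step is a finite check
-- over residues.
module Submission where

open import Defs
open import Algebra.Bundles.Raw using (RawRing)
open import Data.Fin using (Fin; toℕ; fromℕ<; _↑ˡ_; _↑ʳ_)
open import Data.Fin.Patterns using (0F; 1F; 2F; 3F; 4F; 5F; 6F; 7F)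
open import Data.Integer using (ℤ; +_)

-- Written over a raw ring so that the same polynomials can be read in ℤ and, as
-- ring-solver expressions, in the proofs of the identities in ℤ[ζ₁₆] below.
module Formulas {ℓ} (R : RawRing ℓ ℓ) (κ : ℤ → RawRing.Carrier R) where
  open RawRing R

  private
    infixl 6 _-_
    _-_ : Carrier → Carrier → Carrier
    x - y = x + - y

    two four : Carrier
    two = κ (+ 2)
    four = κ (+ 4)

  mod-x⁸+1 : (Fin 16 → Carrier) → Fin 8 → Carrier
  mod-x⁸+1 a i = a (i ↑ˡ 8) - a (8 ↑ʳ i)

  -- The indices are written so as to agree definitionally with those of
  -- mod-x⁸+1 a (i ↑ˡ 4) and mod-x⁸+1 a (4 ↑ʳ i).
  mod-x⁴+1 mod-x⁴-1 : (Fin 16 → Carrier) → Fin 4 → Carrier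
  mod-x⁴+1 a i = a (i ↑ˡ 4 ↑ˡ 8) - a ((4 ↑ʳ i) ↑ˡ 8) + a (8 ↑ʳ (i ↑ˡ 4)) - a (12 ↑ʳ i)
  mod-x⁴-1 a i = a (i ↑ˡ 4 ↑ˡ 8) + a ((4 ↑ʳ i) ↑ˡ 8) + a (8 ↑ʳ (i ↑ˡ 4)) + a (12 ↑ʳ i)

  -- (x + ζ y)(x − ζ y) = x² − i y² when ζ² = i, for x = xr + i xi and y = yr + i yi
  norm-re norm-im : Carrier → Carrier → Carrier → Carrier → Carrier
  norm-re xr xi yr yi = xr * xr - xi * xi + two * (yr * yi)
  norm-im xr xi yr yi = two * (xr * xi) - (yr * yr - yi * yi)

  -- For f = Σ bᵢ xⁱ, f(ζ) f(−ζ) = P + ζ² Q with P = P-re + i P-im and Q = Q-re + i Q-im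
  P-re P-im Q-re Q-im : (Fin 8 → Carrier) → Carrier
  P-re b = b 0F * b 0F - b 4F * b 4F - two * (b 2F * b 6F) + two * (b 1F * b 7F + b 3F * b 5F)
  P-im b = two * (b 0F * b 4F) + b 2F * b 2F - b 6F * b 6F - two * (b 1F * b 3F - b 5F * b 7F)
  Q-re b = two * (b 0F * b 2F - b 4F * b 6F) - (b 1F * b 1F - b 5F * b 5F) + two * (b 3F * b 7F)
  Q-im b = two * (b 0F * b 6F + b 2F * b 4F) - two * (b 1F * b 5F) - (b 3F * b 3F - b 7F * b 7F)

  α₁-re α₁-im : (Fin 8 → Carrier) → Carrier
  α₁-re b = norm-re (P-re b) (P-im b) (Q-re b) (Q-im b)
  α₁-im b = norm-im (P-re b) (P-im b) (Q-re b) (Q-im b)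

  α₂-re α₂-im : (Fin 4 → Carrier) → Carrier
  α₂-re d = norm-re (d 0F) (d 2F) (d 1F) (d 3F)
  α₂-im d = norm-im (d 0F) (d 2F) (d 1F) (d 3F)

  N₄ N₈ N₁₆ N-defect : (Fin 4 → Carrier) → Carrier
  N₄ c = (c 0F - c 2F) * (c 0F - c 2F) + (c 1F - c 3F) * (c 1F - c 3F)
  N₈ c = c 0F - c 1F + c 2F - c 3F
  N₁₆ c = c 0F + c 1F + c 2F + c 3F
  N-defect c = two * (c 1F * c 1F + c 3F * c 3F) - four * (c 0F * c 2F) - two

-- The integer operations are opened only here, as they clash with the fields of RawRing.
open import Data.Integer using (ℤ; +_; _+_; _*_; _-_; -_; -1ℤ; ∣_∣; +-*-rawRing)
open import Data.Integer.Divisibility using (_∣_)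
open import Data.Integer.Divisibility.Signed using (divides; ∣ᵤ⇒∣; ∣⇒∣ᵤ)
import Data.Integer.DivMod as ℤ
open import Data.Integer.Tactic.RingSolver using (ring; solve)
open import Data.Fin.Properties using (all?; toℕ-fromℕ<)
open import Data.Nat as ℕ using (ℕ; zero; suc; NonZero)
open import Data.Nat.Divisibility using (_∣?_)
open import Data.List as List using (List; _∷_; [])
import Data.List.Properties as List
open import Data.Vec as Vec using (Vec; lookup; tabulate)
import Data.Vec.Properties as Vec
open import Data.Product using (_,_)
open import Data.Sum as Sum using (_⊎_; inj₁; inj₂)
open import Function using (id; _∘_)
open import Relation.Nullary.Decidable using (Dec; map′; _⊎-dec_; _→-dec_; from-yes)
open import Relation.Binary.PropositionalEquality using (_≡_; refl; sym; trans; cong; cong₂; subst; module ≡-Reasoning)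
open import Tactic.RingSolver.Core.Expression using (Expr; Κ; Ι; _⊕_; _⊗_; ⊝_; _⊛_)
open import Tactic.RingSolver.NonReflective ring using (module Ops)
open Ops using (⟦_⟧; ⟦_⇓⟧; prove)
open import Algebra.Definitions.RawSemiring (RawRing.rawSemiring +-*-rawRing) using (_^′_)

open Formulas +-*-rawRing id

infix 4 _≡_mod_ _≡?_mod_
infixr 4 _,_
record _≡_mod_ (x y m : ℤ) : Set where
  constructor _,_
  field
    quotient : ℤ
    equation : x ≡ y + quotient * m

mod⇒∣ : ∀ {x y m} → x ≡ y mod m → m ∣ x - y
mod⇒∣ {y = y} {m} (k , refl) = ∣⇒∣ᵤ {m} {y + k * m - y} (divides k (solve (y ∷ k ∷ m ∷ [])))

∣⇒mod : ∀ {x y m} → m ∣ x - y → x ≡ y mod m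
∣⇒mod {x} {y} {m} m∣x-y with ∣ᵤ⇒∣ m∣x-y
... | divides k eq = k , (begin
  x           ≡⟨ solve (x ∷ y ∷ []) ⟩
  y + (x - y) ≡⟨ cong (_+_ y) eq ⟩
  y + k * m   ∎)
  where open ≡-Reasoning

_≡?_mod_ : ∀ x y m → Dec (x ≡ y mod m)
x ≡? y mod m = map′ ∣⇒mod mod⇒∣ (∣ m ∣ ∣? ∣ x - y ∣)

≡0-mod⇒∣ : ∀ {x m} → x ≡ + 0 mod m → m ∣ x
≡0-mod⇒∣ {m = m} (k , refl) = ∣⇒∣ᵤ {m} {+ 0 + k * m} (divides k (solve (k ∷ m ∷ [])))

mod-refl : ∀ {x m} → x ≡ x mod m
mod-refl {x} {m} = + 0 , solve (x ∷ m ∷ [])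

mod-sym : ∀ {x y m} → x ≡ y mod m → y ≡ x mod m
mod-sym {y = y} {m} (k , refl) = - k , solve (y ∷ k ∷ m ∷ [])

mod-trans : ∀ {x y z m} → x ≡ y mod m → y ≡ z mod m → x ≡ z mod m
mod-trans {z = z} {m} (k , refl) (l , refl) = k + l , solve (z ∷ k ∷ l ∷ m ∷ [])

mod-weaken : ∀ c {x y m} → x ≡ y mod c * m → x ≡ y mod m
mod-weaken c {y = y} {m} (k , refl) = k * c , solve (y ∷ k ∷ c ∷ m ∷ [])

+-cong-mod : ∀ {x x′ y y′ m} → x ≡ x′ mod m → y ≡ y′ mod m → x + y ≡ x′ + y′ mod m
+-cong-mod {x′ = x′} {y′ = y′} {m} (k , refl) (l , refl) = k + l , solve (x′ ∷ y′ ∷ k ∷ l ∷ m ∷ [])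

-‿cong-mod : ∀ {x x′ m} → x ≡ x′ mod m → - x ≡ - x′ mod m
-‿cong-mod {x′ = x′} {m} (k , refl) = - k , solve (x′ ∷ k ∷ m ∷ [])

minus-cong-mod : ∀ {x x′ y y′ m} → x ≡ x′ mod m → y ≡ y′ mod m → x - y ≡ x′ - y′ mod m
minus-cong-mod x≡x′ y≡y′ = +-cong-mod x≡x′ (-‿cong-mod y≡y′)

*-cong-mod : ∀ {x x′ y y′ m} → x ≡ x′ mod m → y ≡ y′ mod m → x * y ≡ x′ * y′ mod m
*-cong-mod {x′ = x′} {y′ = y′} {m} (k , refl) (l , refl) =
  k * y′ + l * x′ + k * l * m , solve (x′ ∷ y′ ∷ k ∷ l ∷ m ∷ [])

*-scale-mod : ∀ c {x y m} → x ≡ y mod m → c * x ≡ c * y mod c * m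
*-scale-mod c {y = y} {m} (k , refl) = k , solve (c ∷ y ∷ k ∷ m ∷ [])

square-lift-mod : ∀ m {x y} → x ≡ y mod + 2 * m → x * x ≡ y * y mod + 4 * m
square-lift-mod m {y = y} (k , refl) = k * y + m * k * k , solve (m ∷ y ∷ k ∷ [])

residue : ℤ → (m : ℕ) .{{_ : NonZero m}} → Fin m
residue x m = fromℕ< (ℤ.n%ℕd<d x m)

≡-residue : ∀ x m .{{_ : NonZero m}} → x ≡ + toℕ (residue x m) mod + m
≡-residue x m = x ℤ./ℕ m , trans (ℤ.a≡a%ℕn+[a/ℕn]*n x m)
  (cong (λ r → + r + x ℤ./ℕ m * + m) (sym (toℕ-fromℕ< (ℤ.n%ℕd<d x m))))

Is±1mod8 : ℤ → Set
Is±1mod8 x = x ≡ + 1 mod + 8 ⊎ x ≡ -1ℤ mod + 8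

is±1mod8? : ∀ x → Dec (Is±1mod8 x)
is±1mod8? x = (x ≡? + 1 mod + 8) ⊎-dec (x ≡? -1ℤ mod + 8)

Is8m±1⇒Is±1mod8 : ∀ {x} → Is8m±1 x → Is±1mod8 x
Is8m±1⇒Is±1mod8 (m , inj₁ refl) = inj₁ (m , solve (m ∷ []))
Is8m±1⇒Is±1mod8 (m , inj₂ refl) = inj₂ (m , solve (m ∷ []))

Is±1mod8-resp : ∀ {x y} → x ≡ y mod + 8 → Is±1mod8 x → Is±1mod8 y
Is±1mod8-resp x≡y = Sum.map (mod-trans (mod-sym x≡y)) (mod-trans (mod-sym x≡y))

norm-re-cong : ∀ {xr xi yr yi xr′ xi′ yr′ yi′} →
  xr ≡ xr′ mod + 4 → xi ≡ xi′ mod + 4 → yr ≡ yr′ mod + 4 → yi ≡ yi′ mod + 4 →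
  norm-re xr xi yr yi ≡ norm-re xr′ xi′ yr′ yi′ mod + 8
norm-re-cong hxr hxi hyr hyi = +-cong-mod
  (+-cong-mod (square-lift-mod (+ 2) hxr) (-‿cong-mod (square-lift-mod (+ 2) hxi)))
  (*-scale-mod (+ 2) (*-cong-mod hyr hyi))

norm-im-cong : ∀ {xr xi yr yi xr′ xi′ yr′ yi′} →
  xr ≡ xr′ mod + 4 → xi ≡ xi′ mod + 4 → yr ≡ yr′ mod + 4 → yi ≡ yi′ mod + 4 →
  norm-im xr xi yr yi ≡ norm-im xr′ xi′ yr′ yi′ mod + 8
norm-im-cong hxr hxi hyr hyi = +-cong-mod
  (*-scale-mod (+ 2) (*-cong-mod hxr hxi))
  (-‿cong-mod (+-cong-mod (square-lift-mod (+ 2) hyr) (-‿cong-mod (square-lift-mod (+ 2) hyi))))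

module _ {b b′ : Fin 8 → ℤ} (b≡b′ : ∀ i → b i ≡ b′ i mod + 2) where
  private
    sq : ∀ i → b i * b i ≡ b′ i * b′ i mod + 4
    sq i = square-lift-mod (+ 1) (b≡b′ i)

    prod : ∀ i j → b i * b j ≡ b′ i * b′ j mod + 2
    prod i j = *-cong-mod (b≡b′ i) (b≡b′ j)

    twice : ∀ {x y} → x ≡ y mod + 2 → + 2 * x ≡ + 2 * y mod + 4
    twice = *-scale-mod (+ 2)

    P-re-cong : P-re b ≡ P-re b′ mod + 4
    P-re-cong = +-cong-mod (minus-cong-mod (minus-cong-mod (sq 0F) (sq 4F)) (twice (prod 2F 6F)))
      (twice (+-cong-mod (prod 1F 7F) (prod 3F 5F)))

    P-im-cong : P-im b ≡ P-im b′ mod + 4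
    P-im-cong = minus-cong-mod (minus-cong-mod (+-cong-mod (twice (prod 0F 4F)) (sq 2F)) (sq 6F))
      (twice (minus-cong-mod (prod 1F 3F) (prod 5F 7F)))

    Q-re-cong : Q-re b ≡ Q-re b′ mod + 4
    Q-re-cong = +-cong-mod (minus-cong-mod (twice (minus-cong-mod (prod 0F 2F) (prod 4F 6F)))
      (minus-cong-mod (sq 1F) (sq 5F))) (twice (prod 3F 7F))

    Q-im-cong : Q-im b ≡ Q-im b′ mod + 4
    Q-im-cong = minus-cong-mod (minus-cong-mod (twice (+-cong-mod (prod 0F 6F) (prod 2F 4F)))
      (twice (prod 1F 5F))) (minus-cong-mod (sq 3F) (sq 7F))

  α₁-re-cong : α₁-re b ≡ α₁-re b′ mod + 8
  α₁-re-cong = norm-re-cong P-re-cong P-im-cong Q-re-cong Q-im-cong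

  α₁-im-cong : α₁-im b ≡ α₁-im b′ mod + 8
  α₁-im-cong = norm-im-cong P-re-cong P-im-cong Q-re-cong Q-im-cong

module _ {d d′ : Fin 4 → ℤ} (d≡d′ : ∀ i → d i ≡ d′ i mod + 4) where
  α₂-re-cong : α₂-re d ≡ α₂-re d′ mod + 8
  α₂-re-cong = norm-re-cong (d≡d′ 0F) (d≡d′ 2F) (d≡d′ 1F) (d≡d′ 3F)

  α₂-im-cong : α₂-im d ≡ α₂-im d′ mod + 8
  α₂-im-cong = norm-im-cong (d≡d′ 0F) (d≡d′ 2F) (d≡d′ 1F) (d≡d′ 3F)

N-defect-cong : ∀ {c c′} → (∀ i → c i ≡ c′ i mod + 4) → N-defect c ≡ N-defect c′ mod + 16
N-defect-cong c≡c′ = minus-cong-mod (minus-cong-mod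
  (*-scale-mod (+ 2) (+-cong-mod (square-lift-mod (+ 2) (c≡c′ 1F)) (square-lift-mod (+ 2) (c≡c′ 3F))))
  (*-scale-mod (+ 4) (*-cong-mod (c≡c′ 0F) (c≡c′ 2F)))) mod-refl

all-vectors? : ∀ {k} n {P : Vec (Fin k) n → Set} → (∀ v → Dec (P v)) → Dec (∀ v → P v)
all-vectors? zero P? = map′ (λ p → λ { Vec.[] → p }) (λ ∀P → ∀P Vec.[]) (P? Vec.[])
all-vectors? (suc n) P? = map′ (λ ∀P → λ { (x Vec.∷ v) → ∀P x v }) (λ ∀P x v → ∀P (x Vec.∷ v))
  (all? λ x → all-vectors? n λ v → P? (x Vec.∷ v))

asℤ : ∀ {k n} → Vec (Fin k) n → Fin n → ℤ
asℤ v i = + toℕ (lookup v i)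

VanishesOnResidues : Set
VanishesOnResidues = ∀ (β : Vec (Fin 2) 8) → Is±1mod8 (α₁-re (asℤ β)) → Is±1mod8 (α₁-im (asℤ β)) →
  ∀ (δ : Vec (Fin 4) 4) → (∀ i → asℤ δ i ≡ asℤ β (i ↑ˡ 4) + asℤ β (4 ↑ʳ i) mod + 2) →
  Is±1mod8 (α₂-re (asℤ δ)) → Is±1mod8 (α₂-im (asℤ δ)) →
  N-defect (λ i → asℤ δ i + + 2 * asℤ β (4 ↑ʳ i)) ≡ + 0 mod + 16

vanishes-on-residues : VanishesOnResidues
vanishes-on-residues = from-yes (all-vectors? {2} 8 λ β →
  is±1mod8? (α₁-re (asℤ β)) →-dec is±1mod8? (α₁-im (asℤ β)) →-dec all-vectors? {4} 4 λ δ →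
  (all? λ i → asℤ δ i ≡? asℤ β (i ↑ˡ 4) + asℤ β (4 ↑ʳ i) mod + 2) →-dec
  is±1mod8? (α₂-re (asℤ δ)) →-dec is±1mod8? (α₂-im (asℤ δ)) →-dec
  N-defect (λ i → asℤ δ i + + 2 * asℤ β (4 ↑ʳ i)) ≡? + 0 mod + 16)

N-defect-vanishes : ∀ (b : Fin 8 → ℤ) (d c : Fin 4 → ℤ) →
  (∀ i → d i ≡ b (i ↑ˡ 4) + b (4 ↑ʳ i) mod + 2) →
  (∀ i → c i ≡ d i + + 2 * b (4 ↑ʳ i) mod + 4) →
  Is±1mod8 (α₁-re b) → Is±1mod8 (α₁-im b) → Is±1mod8 (α₂-re d) → Is±1mod8 (α₂-im d) →
  N-defect c ≡ + 0 mod + 16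
N-defect-vanishes b d c d≡b+b c≡d+2b h₁ h₂ h₃ h₄ = mod-trans (N-defect-cong c≡δ+2β)
  (vanishes-on-residues β (Is±1mod8-resp (α₁-re-cong b≡β) h₁) (Is±1mod8-resp (α₁-im-cong b≡β) h₂)
    δ δ≡β+β (Is±1mod8-resp (α₂-re-cong d≡δ) h₃) (Is±1mod8-resp (α₂-im-cong d≡δ) h₄))
  where
  β : Vec (Fin 2) 8
  β = tabulate λ i → residue (b i) 2

  δ : Vec (Fin 4) 4
  δ = tabulate λ i → residue (d i) 4

  b≡β : ∀ i → b i ≡ asℤ β i mod + 2
  b≡β i rewrite Vec.lookup∘tabulate (λ j → residue (b j) 2) i = ≡-residue (b i) 2

  d≡δ : ∀ i → d i ≡ asℤ δ i mod + 4
  d≡δ i rewrite Vec.lookup∘tabulate (λ j → residue (d j) 4) i = ≡-residue (d i) 4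

  δ≡β+β : ∀ i → asℤ δ i ≡ asℤ β (i ↑ˡ 4) + asℤ β (4 ↑ʳ i) mod + 2
  δ≡β+β i = mod-trans (mod-sym (mod-weaken (+ 2) (d≡δ i))) (mod-trans (d≡b+b i) (+-cong-mod (b≡β _) (b≡β _)))

  c≡δ+2β : ∀ i → c i ≡ asℤ δ i + + 2 * asℤ β (4 ↑ʳ i) mod + 4
  c≡δ+2β i = mod-trans (c≡d+2b i) (+-cong-mod (d≡δ i) (*-scale-mod (+ 2) (b≡β _)))

private
  alternating-sum-mod-2 : ∀ x y z w → x - y + z - w ≡ (x - z) + (y - w) mod + 2
  alternating-sum-mod-2 x y z w = z - y , solve (x ∷ y ∷ z ∷ w ∷ [])

  sum-mod-4 : ∀ x y z w → x + y + z + w ≡ (x - y + z - w) + + 2 * (y - w) mod + 4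
  sum-mod-4 x y z w = w , solve (x ∷ y ∷ z ∷ w ∷ [])

mod-x⁴+1-from-mod-x⁸+1 : ∀ a i → mod-x⁴+1 a i ≡ mod-x⁸+1 a (i ↑ˡ 4) + mod-x⁸+1 a (4 ↑ʳ i) mod + 2
mod-x⁴+1-from-mod-x⁸+1 a i =
  alternating-sum-mod-2 (a (i ↑ˡ 4 ↑ˡ 8)) (a ((4 ↑ʳ i) ↑ˡ 8)) (a (8 ↑ʳ (i ↑ˡ 4))) (a (12 ↑ʳ i))

mod-x⁴-1-from-mod-x⁴+1 : ∀ a i → mod-x⁴-1 a i ≡ mod-x⁴+1 a i + + 2 * mod-x⁸+1 a (4 ↑ʳ i) mod + 4
mod-x⁴-1-from-mod-x⁴+1 a i =
  sum-mod-4 (a (i ↑ˡ 4 ↑ˡ 8)) (a ((4 ↑ʳ i) ↑ˡ 8)) (a (8 ↑ʳ (i ↑ˡ 4))) (a (12 ↑ʳ i))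

open import Data.Vec using ([]; _∷_)

-- The arithmetic of Cyc mirrored on ring-solver expressions. Interpretation commutes with
-- it, so identities in ℤ[ζ₁₆] become coordinatewise polynomial identities, which are
-- decided by comparing normal forms.
Expr-rawRing : ℕ → RawRing _ _
Expr-rawRing n = record
  { Carrier = Expr ℤ n ; _≈_ = _≡_ ; _+_ = _⊕_ ; _*_ = _⊗_ ; -_ = ⊝_ ; 0# = Κ (+ 0) ; 1# = Κ (+ 1) }

module Sym {n} = Formulas (Expr-rawRing n) Κ

CycExpr : ℕ → Set
CycExpr n = Vec (Expr ℤ n) 8

module _ {n : ℕ} where
  zeroᴱ oneᴱ : CycExpr n
  zeroᴱ = Vec.map Κ zeroC
  oneᴱ = Vec.map Κ oneC

  addᴱ : CycExpr n → CycExpr n → CycExpr n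
  addᴱ = Vec.zipWith _⊕_

  scaleᴱ : Expr ℤ n → CycExpr n → CycExpr n
  scaleᴱ c = Vec.map (c ⊗_)

  mulζᴱ : CycExpr n → CycExpr n
  mulζᴱ (a₀ ∷ a₁ ∷ a₂ ∷ a₃ ∷ a₄ ∷ a₅ ∷ a₆ ∷ a₇ ∷ []) = ⊝ a₇ ∷ a₀ ∷ a₁ ∷ a₂ ∷ a₃ ∷ a₄ ∷ a₅ ∷ a₆ ∷ []

  mulAuxᴱ : List (Expr ℤ n) → CycExpr n → CycExpr n
  mulAuxᴱ [] b = zeroᴱ
  mulAuxᴱ (c ∷ cs) b = addᴱ (scaleᴱ c b) (mulAuxᴱ cs (mulζᴱ b))

  mulᴱ : CycExpr n → CycExpr n → CycExpr n
  mulᴱ a = mulAuxᴱ (Vec.toList a)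

  prodᴱ : List (CycExpr n) → CycExpr n
  prodᴱ = List.foldr mulᴱ oneᴱ

  ⟦_⟧ᵛ : ∀ {m} → Vec (Expr ℤ n) m → Vec ℤ n → Vec ℤ m
  ⟦ v ⟧ᵛ ρ = Vec.map (λ e → ⟦ e ⟧ ρ) v

  ⟦_⇓⟧ᵛ : ∀ {m} → Vec (Expr ℤ n) m → Vec ℤ n → Vec ℤ m
  ⟦ v ⇓⟧ᵛ ρ = Vec.map (λ e → ⟦ e ⇓⟧ ρ) v

  proveᵛ : ∀ {m} ρ (u v : Vec (Expr ℤ n) m) → ⟦ u ⇓⟧ᵛ ρ ≡ ⟦ v ⇓⟧ᵛ ρ → ⟦ u ⟧ᵛ ρ ≡ ⟦ v ⟧ᵛ ρ
  proveᵛ ρ [] [] _ = refl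
  proveᵛ ρ (x ∷ u) (y ∷ v) eq =
    cong₂ _∷_ (prove ρ x y (Vec.∷-injectiveˡ eq)) (proveᵛ ρ u v (Vec.∷-injectiveʳ eq))

  module _ (ρ : Vec ℤ n) where
    ⟦⟧-map-Κ : ∀ {m} (z : Vec ℤ m) → ⟦ Vec.map Κ z ⟧ᵛ ρ ≡ z
    ⟦⟧-map-Κ z = trans (sym (Vec.map-∘ _ Κ z)) (Vec.map-id z)

    ⟦⟧-zipWith-⊕ : ∀ {m} (u v : Vec (Expr ℤ n) m) → ⟦ Vec.zipWith _⊕_ u v ⟧ᵛ ρ ≡ Vec.zipWith _+_ (⟦ u ⟧ᵛ ρ) (⟦ v ⟧ᵛ ρ)
    ⟦⟧-zipWith-⊕ [] [] = refl
    ⟦⟧-zipWith-⊕ (x ∷ u) (y ∷ v) = cong (_ ∷_) (⟦⟧-zipWith-⊕ u v)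

    ⟦⟧-scaleC : ∀ c (u : CycExpr n) → ⟦ scaleᴱ c u ⟧ᵛ ρ ≡ scaleC (⟦ c ⟧ ρ) (⟦ u ⟧ᵛ ρ)
    ⟦⟧-scaleC c u = trans (sym (Vec.map-∘ _ _ u)) (Vec.map-∘ _ _ u)

    ⟦⟧-mulζ : ∀ u → ⟦ mulζᴱ u ⟧ᵛ ρ ≡ mulζ (⟦ u ⟧ᵛ ρ)
    ⟦⟧-mulζ (_ ∷ _ ∷ _ ∷ _ ∷ _ ∷ _ ∷ _ ∷ _ ∷ []) = refl

    ⟦⟧-mulAux : ∀ cs u → ⟦ mulAuxᴱ cs u ⟧ᵛ ρ ≡ mulAux (List.map (λ e → ⟦ e ⟧ ρ) cs) (⟦ u ⟧ᵛ ρ)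
    ⟦⟧-mulAux [] u = ⟦⟧-map-Κ zeroC
    ⟦⟧-mulAux (c ∷ cs) u = begin
      ⟦ addᴱ (scaleᴱ c u) (mulAuxᴱ cs (mulζᴱ u)) ⟧ᵛ ρ
        ≡⟨ ⟦⟧-zipWith-⊕ (scaleᴱ c u) _ ⟩
      addC (⟦ scaleᴱ c u ⟧ᵛ ρ) (⟦ mulAuxᴱ cs (mulζᴱ u) ⟧ᵛ ρ)
        ≡⟨ cong₂ addC (⟦⟧-scaleC c u) (trans (⟦⟧-mulAux cs (mulζᴱ u)) (cong (mulAux (List.map (λ e → ⟦ e ⟧ ρ) cs)) (⟦⟧-mulζ u))) ⟩
      addC (scaleC (⟦ c ⟧ ρ) (⟦ u ⟧ᵛ ρ)) (mulAux (List.map (λ e → ⟦ e ⟧ ρ) cs) (mulζ (⟦ u ⟧ᵛ ρ))) ∎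
      where open ≡-Reasoning

    ⟦⟧-mulC : ∀ u v → ⟦ mulᴱ u v ⟧ᵛ ρ ≡ mulC (⟦ u ⟧ᵛ ρ) (⟦ v ⟧ᵛ ρ)
    ⟦⟧-mulC u v = trans (⟦⟧-mulAux (Vec.toList u) v) (cong (λ cs → mulAux cs (⟦ v ⟧ᵛ ρ)) (sym (Vec.toList-map _ u)))

    ⟦⟧-prodC : ∀ vs → ⟦ prodᴱ vs ⟧ᵛ ρ ≡ prodC (List.map (λ v → ⟦ v ⟧ᵛ ρ) vs)
    ⟦⟧-prodC [] = ⟦⟧-map-Κ oneC
    ⟦⟧-prodC (v ∷ vs) = trans (⟦⟧-mulC v (prodᴱ vs)) (cong (mulC (⟦ v ⟧ᵛ ρ)) (⟦⟧-prodC vs))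

evalAtᴱ : ℕ → CycExpr 16
evalAtᴱ l = List.foldr addᴱ zeroᴱ (List.map (λ k → scaleᴱ (Ι k) (Vec.map Κ (ζpow (l ℕ.* toℕ k)))) (List.allFin 16))

⟦⟧-evalAt : ∀ a l → ⟦ evalAtᴱ l ⟧ᵛ (tabulate a) ≡ evalAt a l
⟦⟧-evalAt a l = go (List.allFin 16)
  where
  term : Fin 16 → CycExpr 16
  term k = scaleᴱ (Ι k) (Vec.map Κ (ζpow (l ℕ.* toℕ k)))
  go : ∀ ks → ⟦ List.foldr addᴱ zeroᴱ (List.map term ks) ⟧ᵛ (tabulate a)
            ≡ List.foldr addC zeroC (List.map (λ k → scaleC (a k) (ζpow (l ℕ.* toℕ k))) ks)
  go [] = ⟦⟧-map-Κ (tabulate a) zeroC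
  go (k ∷ ks) = trans (⟦⟧-zipWith-⊕ (tabulate a) (term k) _) (cong₂ addC
    (trans (⟦⟧-scaleC (tabulate a) (Ι k) _) (cong₂ scaleC (Vec.lookup∘tabulate a k) (⟦⟧-map-Κ (tabulate a) _)))
    (go ks))

infix 9 _[_]
_[_] : ∀ {k n} → Expr ℤ k → (Fin k → Expr ℤ n) → Expr ℤ n
Κ x [ σ ] = Κ x
Ι i [ σ ] = σ i
(x ⊕ y) [ σ ] = x [ σ ] ⊕ y [ σ ]
(x ⊗ y) [ σ ] = x [ σ ] ⊗ y [ σ ]
(x ⊛ i) [ σ ] = x [ σ ] ⊛ i
(⊝ x) [ σ ] = ⊝ x [ σ ]

⟦⟧-[] : ∀ {k n} (e : Expr ℤ k) (σ : Fin k → Expr ℤ n) ρ → ⟦ e [ σ ] ⟧ ρ ≡ ⟦ e ⟧ (tabulate λ i → ⟦ σ i ⟧ ρ)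
⟦⟧-[] (Κ x) σ ρ = refl
⟦⟧-[] (Ι i) σ ρ = sym (Vec.lookup∘tabulate _ i)
⟦⟧-[] (x ⊕ y) σ ρ = cong₂ _+_ (⟦⟧-[] x σ ρ) (⟦⟧-[] y σ ρ)
⟦⟧-[] (x ⊗ y) σ ρ = cong₂ _*_ (⟦⟧-[] x σ ρ) (⟦⟧-[] y σ ρ)
⟦⟧-[] (x ⊛ i) σ ρ = cong (_^′ i) (⟦⟧-[] x σ ρ)
⟦⟧-[] (⊝ x) σ ρ = cong -_ (⟦⟧-[] x σ ρ)

images-at : ∀ {k} → Vec ℤ k → List (CycExpr k) → List Cyc
images-at ρ = List.map (λ v → ⟦ v ⟧ᵛ ρ)

-- Each f(ζˡ) is matched, by identities linear in the sixteen coefficients, with an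
-- expression in the k reduced coefficients σ. Products are then normalised only in those k
-- variables, and over a variable environment, which is far cheaper than in all sixteen.
evalAt-images : ∀ {k} a (σ : Fin k → Expr ℤ 16) ls imgs →
  List.map (λ l → ⟦ evalAtᴱ l ⇓⟧ᵛ (tabulate a)) ls ≡ List.map (λ v → ⟦ Vec.map _[ σ ] v ⇓⟧ᵛ (tabulate a)) imgs →
  List.map (evalAt a) ls ≡ images-at (tabulate λ i → ⟦ σ i ⟧ (tabulate a)) imgs
evalAt-images a σ [] [] _ = refl
evalAt-images a σ (l ∷ ls) (v ∷ vs) eq =
  cong₂ _∷_ image (evalAt-images a σ ls vs (List.∷-injectiveʳ eq))
  where
  open ≡-Reasoning
  image : evalAt a l ≡ ⟦ v ⟧ᵛ (tabulate λ i → ⟦ σ i ⟧ (tabulate a))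
  image = begin
    evalAt a l                                        ≡⟨ ⟦⟧-evalAt a l ⟨
    ⟦ evalAtᴱ l ⟧ᵛ (tabulate a)                        ≡⟨ proveᵛ (tabulate a) (evalAtᴱ l) (Vec.map _[ σ ] v) (List.∷-injectiveˡ eq) ⟩
    ⟦ Vec.map _[ σ ] v ⟧ᵛ (tabulate a)                 ≡⟨ Vec.map-∘ _ _ v ⟨
    Vec.map (λ e → ⟦ e [ σ ] ⟧ (tabulate a)) v        ≡⟨ Vec.map-cong (λ e → ⟦⟧-[] e σ (tabulate a)) v ⟩
    ⟦ v ⟧ᵛ (tabulate λ i → ⟦ σ i ⟧ (tabulate a))      ∎

coefficient-of-product : ∀ {k} i (imgs : List (CycExpr k)) e ρ → ⟦ lookup (prodᴱ imgs) i ⇓⟧ ρ ≡ ⟦ e ⇓⟧ ρ →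
  lookup (prodC (images-at ρ imgs)) i ≡ ⟦ e ⟧ ρ
coefficient-of-product i imgs e ρ eq = begin
  lookup (prodC (images-at ρ imgs)) i ≡⟨ cong (λ v → lookup v i) (⟦⟧-prodC ρ imgs) ⟨
  lookup (⟦ prodᴱ imgs ⟧ᵛ ρ) i        ≡⟨ Vec.lookup-map i _ (prodᴱ imgs) ⟩
  ⟦ lookup (prodᴱ imgs) i ⟧ ρ          ≡⟨ prove ρ (lookup (prodᴱ imgs) i) e eq ⟩
  ⟦ e ⟧ ρ                              ∎
  where open ≡-Reasoning

-- f(ζ), f(ζ⁵), f(ζ⁹), f(ζ¹³) for f = Σ bᵢ xⁱ
α₁-images : List (CycExpr 8)
α₁-images =
  (Ι 0F ∷ Ι 1F ∷ Ι 2F ∷ Ι 3F ∷ Ι 4F ∷ Ι 5F ∷ Ι 6F ∷ Ι 7F ∷ []) ∷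
  (Ι 0F ∷ ⊝ Ι 5F ∷ ⊝ Ι 2F ∷ Ι 7F ∷ Ι 4F ∷ Ι 1F ∷ ⊝ Ι 6F ∷ ⊝ Ι 3F ∷ []) ∷
  (Ι 0F ∷ ⊝ Ι 1F ∷ Ι 2F ∷ ⊝ Ι 3F ∷ Ι 4F ∷ ⊝ Ι 5F ∷ Ι 6F ∷ ⊝ Ι 7F ∷ []) ∷
  (Ι 0F ∷ Ι 5F ∷ ⊝ Ι 2F ∷ ⊝ Ι 7F ∷ Ι 4F ∷ ⊝ Ι 1F ∷ ⊝ Ι 6F ∷ Ι 3F ∷ []) ∷ []

Re-α₁-images : ∀ b → Re (prodC (images-at (tabulate b) α₁-images)) ≡ α₁-re b
Re-α₁-images b = coefficient-of-product 0F α₁-images (Sym.α₁-re Ι) (tabulate b) refl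

Im-α₁-images : ∀ b → Im (prodC (images-at (tabulate b) α₁-images)) ≡ α₁-im b
Im-α₁-images b = coefficient-of-product 4F α₁-images (Sym.α₁-im Ι) (tabulate b) refl

α₁-evaluations : ∀ a → List.map (evalAt a) (1 ∷ 5 ∷ 9 ∷ 13 ∷ []) ≡ images-at (tabulate (mod-x⁸+1 a)) α₁-images
α₁-evaluations a = evalAt-images a (Sym.mod-x⁸+1 Ι) (1 ∷ 5 ∷ 9 ∷ 13 ∷ []) α₁-images refl

Re-α₁ : ∀ a → Re (α₁ a) ≡ α₁-re (mod-x⁸+1 a)
Re-α₁ a = trans (cong (Re ∘ prodC) (α₁-evaluations a)) (Re-α₁-images (mod-x⁸+1 a))

Im-α₁ : ∀ a → Im (α₁ a) ≡ α₁-im (mod-x⁸+1 a)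
Im-α₁ a = trans (cong (Im ∘ prodC) (α₁-evaluations a)) (Im-α₁-images (mod-x⁸+1 a))

private
  0ᴱ : ∀ {k} → Expr ℤ k
  0ᴱ = Κ (+ 0)

-- f(ζ²), f(ζ¹⁰) for f = Σ dᵢ xⁱ
α₂-images : List (CycExpr 4)
α₂-images =
  (Ι 0F ∷ 0ᴱ ∷ Ι 1F ∷ 0ᴱ ∷ Ι 2F ∷ 0ᴱ ∷ Ι 3F ∷ 0ᴱ ∷ []) ∷
  (Ι 0F ∷ 0ᴱ ∷ ⊝ Ι 1F ∷ 0ᴱ ∷ Ι 2F ∷ 0ᴱ ∷ ⊝ Ι 3F ∷ 0ᴱ ∷ []) ∷ []

Re-α₂-images : ∀ d → Re (prodC (images-at (tabulate d) α₂-images)) ≡ α₂-re d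
Re-α₂-images d = coefficient-of-product 0F α₂-images (Sym.α₂-re Ι) (tabulate d) refl

Im-α₂-images : ∀ d → Im (prodC (images-at (tabulate d) α₂-images)) ≡ α₂-im d
Im-α₂-images d = coefficient-of-product 4F α₂-images (Sym.α₂-im Ι) (tabulate d) refl

α₂-evaluations : ∀ a → List.map (evalAt a) (2 ∷ 10 ∷ []) ≡ images-at (tabulate (mod-x⁴+1 a)) α₂-images
α₂-evaluations a = evalAt-images a (Sym.mod-x⁴+1 Ι) (2 ∷ 10 ∷ []) α₂-images refl

Re-α₂ : ∀ a → Re (α₂ a) ≡ α₂-re (mod-x⁴+1 a)
Re-α₂ a = trans (cong (Re ∘ prodC) (α₂-evaluations a)) (Re-α₂-images (mod-x⁴+1 a))

Im-α₂ : ∀ a → Im (α₂ a) ≡ α₂-im (mod-x⁴+1 a)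
Im-α₂ a = trans (cong (Im ∘ prodC) (α₂-evaluations a)) (Im-α₂-images (mod-x⁴+1 a))

-- f(ζ⁴), f(ζ¹²); f(ζ⁸); f(1) for f = Σ cᵢ xⁱ
N₄-images N₈-images N₁₆-images : List (CycExpr 4)
N₄-images =
  (Ι 0F ⊕ ⊝ Ι 2F ∷ 0ᴱ ∷ 0ᴱ ∷ 0ᴱ ∷ Ι 1F ⊕ ⊝ Ι 3F ∷ 0ᴱ ∷ 0ᴱ ∷ 0ᴱ ∷ []) ∷
  (Ι 0F ⊕ ⊝ Ι 2F ∷ 0ᴱ ∷ 0ᴱ ∷ 0ᴱ ∷ ⊝ (Ι 1F ⊕ ⊝ Ι 3F) ∷ 0ᴱ ∷ 0ᴱ ∷ 0ᴱ ∷ []) ∷ []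
N₈-images = (Sym.N₈ Ι ∷ 0ᴱ ∷ 0ᴱ ∷ 0ᴱ ∷ 0ᴱ ∷ 0ᴱ ∷ 0ᴱ ∷ 0ᴱ ∷ []) ∷ []
N₁₆-images = (Sym.N₁₆ Ι ∷ 0ᴱ ∷ 0ᴱ ∷ 0ᴱ ∷ 0ᴱ ∷ 0ᴱ ∷ 0ᴱ ∷ 0ᴱ ∷ []) ∷ []

N-combination : List Cyc → List Cyc → List Cyc → ℤ
N-combination x₄ x₈ x₁₆ = Re (prodC x₄) - (Re (prodC x₈) * Re (prodC x₁₆) + + 2)

N-defect-images : ∀ c →
  N-combination (images-at (tabulate c) N₄-images) (images-at (tabulate c) N₈-images) (images-at (tabulate c) N₁₆-images)
  ≡ N-defect c
N-defect-images c = begin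
  N-combination (images-at ρ N₄-images) (images-at ρ N₈-images) (images-at ρ N₁₆-images)
    ≡⟨ cong₂ (λ x yz → x - (yz + + 2)) (coefficient-of-product 0F N₄-images (Sym.N₄ Ι) ρ refl)
         (cong₂ _*_ (coefficient-of-product 0F N₈-images (Sym.N₈ Ι) ρ refl)
                    (coefficient-of-product 0F N₁₆-images (Sym.N₁₆ Ι) ρ refl)) ⟩
  N₄ c - (N₈ c * N₁₆ c + + 2)
    ≡⟨ prove ρ (Sym.N₄ Ι ⊕ ⊝ (Sym.N₈ Ι ⊗ Sym.N₁₆ Ι ⊕ Κ (+ 2))) (Sym.N-defect Ι) refl ⟩
  N-defect c ∎
  where
  open ≡-Reasoning
  ρ : Vec ℤ 4
  ρ = tabulate c

private
  cong₃ : ∀ {A B C D : Set} (f : A → B → C → D) {x x′ y y′ z z′} →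
    x ≡ x′ → y ≡ y′ → z ≡ z′ → f x y z ≡ f x′ y′ z′
  cong₃ f refl refl refl = refl

N-identity : ∀ a → N a 4 - (N a 8 * N a 16 + + 2) ≡ N-defect (mod-x⁴-1 a)
N-identity a = trans
  (cong₃ N-combination (evalAt-images a (Sym.mod-x⁴-1 Ι) (4 ∷ 12 ∷ []) N₄-images refl)
                       (evalAt-images a (Sym.mod-x⁴-1 Ι) (8 ∷ []) N₈-images refl)
                       (evalAt-images a (Sym.mod-x⁴-1 Ι) (0 ∷ []) N₁₆-images refl))
  (N-defect-images (mod-x⁴-1 a))

lemma4p7 : (a : Fin 16 → ℤ) →
    Is8m±1 (Re (α₁ a)) → Is8m±1 (Im (α₁ a)) →
    Is8m±1 (Re (α₂ a)) → Is8m±1 (Im (α₂ a)) →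
    (+ 16) ∣ (N a 4 - (N a 8 * N a 16 + + 2))
lemma4p7 a h₁ h₂ h₃ h₄ = subst (λ z → + 16 ∣ z) (sym (N-identity a))
  (≡0-mod⇒∣ (N-defect-vanishes (mod-x⁸+1 a) (mod-x⁴+1 a) (mod-x⁴-1 a)
    (mod-x⁴+1-from-mod-x⁸+1 a) (mod-x⁴-1-from-mod-x⁴+1 a)
    (transport (Re-α₁ a) h₁) (transport (Im-α₁ a) h₂) (transport (Re-α₂ a) h₃) (transport (Im-α₂ a) h₄)))
  where
  transport : ∀ {x y} → x ≡ y → Is8m±1 x → Is±1mod8 y
  transport refl = Is8m±1⇒Is±1mod8
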